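{- Let $A=(A_1,\dots,A_k)$ be a pinwheel packing instance and let $\theta\in\mathbb{N}$. Define: - $A_f=(\lfloor\frac97 A_1\rfloor,\dots,\lfloor\frac97A_k\rfloor)$; - $B=\mathrm{pfold}_\theta(A)=(B_1,\dots,B_{k'})$; - $C=(\lfloor\frac97B_1\rfloor,\dots,\lfloor\frac97B_{k'}\rfloor)$. If $C$ is schedulable, then $A_f$ is schedulable.
   Context: A pinwheel packing instance is a finite list of positive integers (periods). A schedule assigns each day in $\mathbb{N}$ to exactly one job. It is valid if for every job $i$ with period $a_i$, every block of $a_i$ consecutive days contains at least one day assigned to job $i$. The instance is schedulable if a valid schedule exists. The fold operation $\mathrm{pfold}_\theta(A)$ repeats the following while $\max(A)>\theta$. Let $a$ and $b$ be the largest and second largest values in $A$ (counted with repetition). If $b>\theta$, remove $a$ and $b$ and add one element $b/2$. Otherwise, remove $a$ and add one element $\theta$. When the loop ends, return the resulting multiset. -}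

module Defs where

open import Data.Nat using (ℕ; zero; suc; _+_; _*_; _≤_; _<_)
open import Data.Nat.DivMod using (_/_)
open import Data.Fin using (Fin)
open import Data.List using (List; []; _∷_; length; map; reverse; lookup)
open import Data.Product using (Σ; ∃; _×_)
open import Data.Integer using (∣_∣; +_)
open import Relation.Binary.PropositionalEquality using (_≡_)
open import Relation.Nullary using (does)
open import Data.Bool using (if_then_else_)
open import Data.Rational as ℚ using (ℚ; ½; floor)
import Data.Rational.Properties as ℚP
open import Data.List.Sort.InsertionSort.Base ℚP.≤-decTotalOrder using (sort)

IsValidSchedule : (A : List ℕ) → (ℕ → Fin (length A)) → Set
IsValidSchedule A s =
  (i : Fin (length A)) (t : ℕ) →
    ∃ λ d → t ≤ d × d < t + lookup A i × s d ≡ i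

Schedulable : List ℕ → Set
Schedulable A = Σ (ℕ → Fin (length A)) (IsValidSchedule A)

scale97ℕ : ℕ → ℕ
scale97ℕ a = (9 * a) / 7

nineSevenths : ℚ
nineSevenths = + 9 ℚ./ 7

scale97ℚ : ℚ → ℕ
scale97ℚ x = ∣ floor (nineSevenths ℚ.* x) ∣

-- Values are rationals (halving may produce non-integers).
-- One step of the loop, on the list sorted in decreasing order
-- (a = largest, b = second largest, counted with repetition).

pfoldStep : ℚ → List ℚ → List ℚ
pfoldStep θ xs = go (reverse (sort xs))
  where
  go : List ℚ → List ℚ
  go [] = []
  go (a ∷ []) = if does (θ ℚP.<? a) then θ ∷ [] else a ∷ []
  go (a ∷ b ∷ rest) =
    if does (θ ℚP.<? a)
      then (if does (θ ℚP.<? b) then (½ ℚ.* b) ∷ rest else θ ∷ b ∷ rest)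
      else a ∷ b ∷ rest

iter : {X : Set} → ℕ → (X → X) → X → X
iter zero f x = x
iter (suc n) f x = iter n f (f x)

toℚ : ℕ → ℚ
toℚ n = + n ℚ./ 1

-- Every step with max > θ decreases the number of elements > θ by at
-- least one, so length-many iterations suffice for the loop to stop;
-- further steps do not change the multiset.
pfold : ℕ → List ℚ → List ℚ
pfold θ xs = iter (length xs) (pfoldStep (toℚ θ)) xs

-- One pfold step either lowers a period a > θ to θ, or replaces the two
-- largest periods a ≥ b > θ by b/2.  The map x ↦ ⌊9/7·x⌋ is monotone and
-- satisfies 2⌊9/7·(b/2)⌋ ≤ ⌊9/7·b⌋, so a schedule of the scaled instance can
-- be pulled back through each step: a job served within the lowered period is
-- served within the original one, and the job of period ⌊9/7·(b/2)⌋ can serve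
-- two jobs whose periods are at least twice as large by handing its visits to
-- them alternately.  Reordering an instance preserves schedulability, and on
-- naturals ⌊9/7·n⌋ computed in ℚ agrees with (9n)/7.

module Submission where

open import Defs
open import Data.Nat as ℕ using (ℕ; zero; suc; _+_; _*_; _≤_; _<_; _≤′_; z≤n; s≤s; _≟_; NonZero; parity)
open import Data.Nat.Properties
open import Data.Nat.DivMod using (_/_; m*n/n≡m; /-monoˡ-≤; m/n*n≤m)
open import Data.Nat.Coprimality using (1-coprimeTo) renaming (sym to Coprime-sym)
open import Data.Integer as ℤ using (+_; -[1+_]; +≤+)
import Data.Integer.Properties as ℤP
open import Data.Integer.DivMod using (div-pos-is-/ℕ)
open import Data.Rational as ℚ using (ℚ; mkℚ; floor; 0ℚ; 1ℚ; ½; fromℚᵘ)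
import Data.Rational.Properties as ℚP
open import Data.Rational.Unnormalised as ℚᵘ using (mkℚᵘ; *≤*)
import Data.Rational.Unnormalised.Properties as ℚᵘP
open import Data.Fin as Fin using (Fin; toℕ)
import Data.Fin.Properties as FinP
open import Data.Parity using (Parity; 0ℙ; 1ℙ)
open import Data.List using (List; []; _∷_; length; lookup; tabulate; map; reverse)
import Data.List.Properties as ListP
open import Data.List.Relation.Unary.All as All using (All; []; _∷_)
import Data.List.Relation.Unary.All.Properties as AllP
open import Data.List.Relation.Unary.AllPairs using (AllPairs; []; _∷_)
import Data.List.Relation.Unary.AllPairs.Properties as AllPairsP
open import Data.List.Relation.Unary.Linked.Properties using (Linked⇒AllPairs)
open import Data.List.Relation.Unary.Unique.Propositional using (Unique)
import Data.List.Relation.Unary.Unique.Propositional.Properties as UniqueP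
open import Data.List.Relation.Binary.Pointwise as Pointwise using (Pointwise; []; _∷_)
open import Data.List.Relation.Binary.Permutation.Propositional as Perm using (_↭_; ↭⇒↭ₛ)
import Data.List.Relation.Binary.Permutation.Propositional.Properties as PermP
import Data.List.Relation.Binary.Permutation.Setoid.Properties as PermS
open import Data.List.Membership.Propositional.Properties using (∈-lookup)
open import Data.List.Extrema ≤-totalOrder using (max; ⊥≤max; xs≤max)
open import Data.List.Sort.InsertionSort.Base ℚP.≤-decTotalOrder using (sort)
open import Data.List.Sort.InsertionSort.Properties ℚP.≤-decTotalOrder using (sort-↭; sort-↗)
open import Data.Product using (∃; _×_; _,_)
open import Data.Sum using (inj₁; inj₂)
open import Data.Empty using (⊥-elim)
open import Function using (_∘_; flip; _⇔_; mk⇔; Equivalence)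
open import Function.Construct.Composition using (_⇔-∘_)
open import Function.Construct.Symmetry using (⇔-sym)
open import Relation.Nullary using (yes; no)
open import Relation.Nullary.Decidable using (dec-true; dec-false)
open import Relation.Binary.PropositionalEquality

open Equivalence

≤/⇔*≤ : ∀ k m d .{{_ : NonZero d}} → k ≤ m / d ⇔ k * d ≤ m
≤/⇔*≤ k m d = mk⇔
  (λ k≤m/d → ≤-trans (*-monoˡ-≤ d k≤m/d) (m/n*n≤m m d))
  (λ k*d≤m → subst (_≤ m / d) (m*n/n≡m k d) (/-monoˡ-≤ d k*d≤m))

fromℚᵘ-≤⇔ : ∀ p q → fromℚᵘ p ℚ.≤ fromℚᵘ q ⇔ p ℚᵘ.≤ q
fromℚᵘ-≤⇔ p q = mk⇔
  (λ h → ℚᵘP.≤-respˡ-≃ (ℚP.toℚᵘ-fromℚᵘ p) (ℚᵘP.≤-respʳ-≃ (ℚP.toℚᵘ-fromℚᵘ q) (ℚP.toℚᵘ-mono-≤ h)))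
  (λ h → ℚP.toℚᵘ-cancel-≤ (ℚᵘP.≤-respˡ-≃ (ℚᵘP.≃-sym (ℚP.toℚᵘ-fromℚᵘ p))
                            (ℚᵘP.≤-respʳ-≃ (ℚᵘP.≃-sym (ℚP.toℚᵘ-fromℚᵘ q)) h)))

toℚ≤/⇔*≤ : ∀ k m d-1 → toℚ k ℚ.≤ + m ℚ./ suc d-1 ⇔ k * suc d-1 ≤ m
toℚ≤/⇔*≤ k m d-1 = mk⇔ to′ from′ ⇔-∘ fromℚᵘ-≤⇔ (mkℚᵘ (+ k) 0) (mkℚᵘ (+ m) d-1)
  where
  d = suc d-1
  to′ : mkℚᵘ (+ k) 0 ℚᵘ.≤ mkℚᵘ (+ m) d-1 → k * d ≤ m
  to′ (*≤* h) = subst₂ _≤_ refl (*-identityʳ m)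
    (ℤP.drop‿+≤+ (subst₂ ℤ._≤_ (sym (ℤP.pos-* k d)) (sym (ℤP.pos-* m 1)) h))
  from′ : k * d ≤ m → mkℚᵘ (+ k) 0 ℚᵘ.≤ mkℚᵘ (+ m) d-1
  from′ h = *≤* (subst₂ ℤ._≤_ (ℤP.pos-* k d) (ℤP.pos-* m 1)
    (+≤+ (subst (k * d ≤_) (sym (*-identityʳ m)) h)))

≤∣floor∣⇔toℚ≤ : ∀ q → 0ℚ ℚ.≤ q → ∀ k → k ≤ ℤ.∣ floor q ∣ ⇔ toℚ k ℚ.≤ q
≤∣floor∣⇔toℚ≤ (mkℚ (+ n) d-1 c) _ k
  rewrite cong ℤ.∣_∣ (div-pos-is-/ℕ (+ n) (suc d-1)) =
  subst (λ q → k ≤ n / suc d-1 ⇔ toℚ k ℚ.≤ q) (ℚP.normalize-coprime c)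
    (⇔-sym (toℚ≤/⇔*≤ k n d-1) ⇔-∘ ≤/⇔*≤ k n (suc d-1))
≤∣floor∣⇔toℚ≤ (mkℚ -[1+ n ] d-1 c) (ℚ.*≤* ()) k

toℚ≡mkℚ : ∀ k → toℚ k ≡ mkℚ (+ k) 0 (Coprime-sym (1-coprimeTo k))
toℚ≡mkℚ k = ℚP.normalize-coprime _

toℚ-+ : ∀ m n → toℚ (m + n) ≡ toℚ m ℚ.+ toℚ n
toℚ-+ m n rewrite toℚ≡mkℚ m | toℚ≡mkℚ n =
  cong (ℚ._/ 1) (trans (ℤP.pos-+ m n)
    (sym (cong₂ ℤ._+_ (ℤP.*-identityʳ (+ m)) (ℤP.*-identityʳ (+ n)))))

0≤toℚ : ∀ k → 0ℚ ℚ.≤ toℚ k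
0≤toℚ k = from (toℚ≤/⇔*≤ 0 k 0) z≤n

0≤* : ∀ {p q} → 0ℚ ℚ.≤ p → 0ℚ ℚ.≤ q → 0ℚ ℚ.≤ p ℚ.* q
0≤* {p} {q} 0≤p 0≤q = ℚP.nonNegative⁻¹ _
  {{ℚP.nonNeg*nonNeg⇒nonNeg p {{ℚ.nonNegative 0≤p}} q {{ℚ.nonNegative 0≤q}}}}

∣floor∣-mono-≤ : ∀ {p q} → 0ℚ ℚ.≤ p → p ℚ.≤ q → ℤ.∣ floor p ∣ ≤ ℤ.∣ floor q ∣
∣floor∣-mono-≤ {p} {q} 0≤p p≤q = from (≤∣floor∣⇔toℚ≤ q (ℚP.≤-trans 0≤p p≤q) _)
  (ℚP.≤-trans (to (≤∣floor∣⇔toℚ≤ p 0≤p _) ≤-refl) p≤q)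

∣floor∣-superadditive : ∀ {p q} → 0ℚ ℚ.≤ p → 0ℚ ℚ.≤ q →
  ℤ.∣ floor p ∣ + ℤ.∣ floor q ∣ ≤ ℤ.∣ floor (p ℚ.+ q) ∣
∣floor∣-superadditive {p} {q} 0≤p 0≤q =
  from (≤∣floor∣⇔toℚ≤ (p ℚ.+ q) (ℚP.+-mono-≤ 0≤p 0≤q) (m + n))
    (subst (ℚ._≤ p ℚ.+ q) (sym (toℚ-+ m n))
      (ℚP.+-mono-≤ (to (≤∣floor∣⇔toℚ≤ p 0≤p m) ≤-refl) (to (≤∣floor∣⇔toℚ≤ q 0≤q n) ≤-refl)))
  where
  m = ℤ.∣ floor p ∣
  n = ℤ.∣ floor q ∣

0≤9/7 : 0ℚ ℚ.≤ nineSevenths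
0≤9/7 = ℚ.*≤* (+≤+ z≤n)

0≤½ : 0ℚ ℚ.≤ ½
0≤½ = ℚ.*≤* (+≤+ z≤n)

scale97ℚ-mono-≤ : ∀ {x y} → 0ℚ ℚ.≤ x → x ℚ.≤ y → scale97ℚ x ≤ scale97ℚ y
scale97ℚ-mono-≤ 0≤x x≤y = ∣floor∣-mono-≤ (0≤* 0≤9/7 0≤x)
  (ℚP.*-monoˡ-≤-nonNeg nineSevenths {{ℚ.nonNegative 0≤9/7}} x≤y)

scale97ℚ-half : ∀ {b} → 0ℚ ℚ.≤ b → scale97ℚ (½ ℚ.* b) + scale97ℚ (½ ℚ.* b) ≤ scale97ℚ b
scale97ℚ-half {b} 0≤b =
  subst (λ x → scale97ℚ (½ ℚ.* b) + scale97ℚ (½ ℚ.* b) ≤ ℤ.∣ floor x ∣) r½b+r½b≡rb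
    (∣floor∣-superadditive 0≤r½b 0≤r½b)
  where
  0≤r½b : 0ℚ ℚ.≤ nineSevenths ℚ.* (½ ℚ.* b)
  0≤r½b = 0≤* 0≤9/7 (0≤* 0≤½ 0≤b)
  r½b+r½b≡rb : nineSevenths ℚ.* (½ ℚ.* b) ℚ.+ nineSevenths ℚ.* (½ ℚ.* b) ≡ nineSevenths ℚ.* b
  r½b+r½b≡rb = begin
    nineSevenths ℚ.* (½ ℚ.* b) ℚ.+ nineSevenths ℚ.* (½ ℚ.* b) ≡⟨ ℚP.*-distribˡ-+ nineSevenths (½ ℚ.* b) (½ ℚ.* b) ⟨
    nineSevenths ℚ.* (½ ℚ.* b ℚ.+ ½ ℚ.* b)                     ≡⟨ cong (nineSevenths ℚ.*_) (ℚP.*-distribʳ-+ b ½ ½) ⟨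
    nineSevenths ℚ.* (1ℚ ℚ.* b)                                ≡⟨ cong (nineSevenths ℚ.*_) (ℚP.*-identityˡ b) ⟩
    nineSevenths ℚ.* b                                         ∎
    where open ≡-Reasoning

9/7*toℚ : ∀ n → nineSevenths ℚ.* toℚ n ≡ + (9 * n) ℚ./ 7
9/7*toℚ n rewrite toℚ≡mkℚ n = cong (ℚ._/ 7) (sym (ℤP.pos-* 9 n))

scale97ℚ-toℚ : ∀ n → scale97ℚ (toℚ n) ≡ scale97ℕ n
scale97ℚ-toℚ n = ≤-antisym (to (≤scale97ℚ⇔≤scale97ℕ _) ≤-refl) (from (≤scale97ℚ⇔≤scale97ℕ _) ≤-refl)
  where
  q = + (9 * n) ℚ./ 7
  0≤q : 0ℚ ℚ.≤ q
  0≤q = from (toℚ≤/⇔*≤ 0 (9 * n) 6) z≤n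
  ≤scale97ℚ⇔≤scale97ℕ : ∀ k → k ≤ scale97ℚ (toℚ n) ⇔ k ≤ scale97ℕ n
  ≤scale97ℚ⇔≤scale97ℕ k = subst (λ x → k ≤ ℤ.∣ floor x ∣ ⇔ k ≤ scale97ℕ n) (sym (9/7*toℚ n))
    (⇔-sym (≤/⇔*≤ k (9 * n) 7) ⇔-∘ (toℚ≤/⇔*≤ k (9 * n) 6 ⇔-∘ ≤∣floor∣⇔toℚ≤ q 0≤q k))

Visits : (ℕ → ℕ) → ℕ → ℕ → Set
Visits s c a = ∀ t → ∃ λ d → t ≤ d × d < t + a × s d ≡ c

Visits-mono : ∀ {s c a b} → a ≤ b → Visits s c a → Visits s c b
Visits-mono a≤b v t with v t
... | d , t≤d , d<t+a , e = d , t≤d , <-≤-trans d<t+a (+-monoʳ-≤ t a≤b) , e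

-- Jobs carry distinct natural labels rather than indices in Fin (length L),
-- so that reordering the instance and splitting a job need no reindexing.
record LabelledSchedule (L : List ℕ) : Set where
  constructor labelled
  field
    schedule : ℕ → ℕ
    labels   : List ℕ
    unique   : Unique labels
    visits   : Pointwise (Visits schedule) labels L

schedulable⇒labelled : ∀ {L} → Schedulable L → LabelledSchedule L
schedulable⇒labelled {L} (s , valid) =
  labelled (toℕ ∘ s) (tabulate toℕ) (UniqueP.tabulate⁺ FinP.toℕ-injective)
    (subst (Pointwise _ _) (ListP.tabulate-lookup L) (Pointwise.tabulate⁺ visits))
  where
  visits : ∀ i → Visits (toℕ ∘ s) (toℕ i) (lookup L i)
  visits i t with valid i t
  ... | d , t≤d , d<t+a , e = d , t≤d , d<t+a , cong toℕ e

indexOf : List ℕ → ℕ → ℕ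
indexOf [] x = 0
indexOf (c ∷ cs) x with x ≟ c
... | yes _ = 0
... | no _ = suc (indexOf cs x)

indexOf-lookup : ∀ {cs} → Unique cs → ∀ i → indexOf cs (lookup cs i) ≡ toℕ i
indexOf-lookup {c ∷ cs} (c∉cs ∷ u) Fin.zero with c ≟ c
... | yes _ = refl
... | no c≢c = ⊥-elim (c≢c refl)
indexOf-lookup {c ∷ cs} (c∉cs ∷ u) (Fin.suc i) with lookup cs i ≟ c
... | yes e = ⊥-elim (All.lookup c∉cs (∈-lookup i) (sym e))
... | no _ = cong suc (indexOf-lookup u i)

clamp : ∀ n → ℕ → Fin (suc n)
clamp zero k = Fin.zero
clamp (suc n) zero = Fin.zero
clamp (suc n) (suc k) = Fin.suc (clamp n k)

clamp-toℕ : ∀ n (i : Fin (suc n)) → clamp n (toℕ i) ≡ i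
clamp-toℕ zero Fin.zero = refl
clamp-toℕ (suc n) Fin.zero = refl
clamp-toℕ (suc n) (Fin.suc i) = cong Fin.suc (clamp-toℕ n i)

labelled⇒schedulable : ∀ {a L} → LabelledSchedule (a ∷ L) → Schedulable (a ∷ L)
labelled⇒schedulable {a} {L} (labelled s cs u vs) = clamp (length L) ∘ indexOf cs ∘ s , valid
  where
  vs′ : Pointwise (λ p c → Visits s c p) (a ∷ L) cs
  vs′ = Pointwise.symmetric (λ v → v) vs
  valid : IsValidSchedule (a ∷ L) (clamp (length L) ∘ indexOf cs ∘ s)
  valid i t with Pointwise.lookup⁺ vs′ i t
  ... | d , t≤d , d<t+a , e = d , t≤d , d<t+a , (begin
    clamp n (indexOf cs (s d))          ≡⟨ cong (clamp n ∘ indexOf cs) e ⟩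
    clamp n (indexOf cs (lookup cs j))  ≡⟨ cong (clamp n) (indexOf-lookup u j) ⟩
    clamp n (toℕ j)                     ≡⟨ cong (clamp n) (FinP.toℕ-cast _ i) ⟩
    clamp n (toℕ i)                     ≡⟨ clamp-toℕ n i ⟩
    i                                   ∎)
    where
    open ≡-Reasoning
    n = length L
    j = Fin.cast (Pointwise.Pointwise-length vs′) i

Pointwise-↭ʳ : ∀ {R : ℕ → ℕ → Set} {cs L M} → L ↭ M → Pointwise R cs L →
  ∃ λ cs′ → cs ↭ cs′ × Pointwise R cs′ M
Pointwise-↭ʳ Perm.refl rs = _ , Perm.refl , rs
Pointwise-↭ʳ (Perm.prep x L↭M) (r ∷ rs) with Pointwise-↭ʳ L↭M rs
... | cs′ , cs↭cs′ , rs′ = _ , Perm.prep _ cs↭cs′ , r ∷ rs′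
Pointwise-↭ʳ (Perm.swap x y L↭M) (r ∷ r′ ∷ rs) with Pointwise-↭ʳ L↭M rs
... | cs′ , cs↭cs′ , rs′ = _ , Perm.swap _ _ cs↭cs′ , r′ ∷ r ∷ rs′
Pointwise-↭ʳ (Perm.trans L↭K K↭M) rs with Pointwise-↭ʳ L↭K rs
... | cs₁ , cs↭cs₁ , rs₁ with Pointwise-↭ʳ K↭M rs₁
... | cs₂ , cs₁↭cs₂ , rs₂ = cs₂ , Perm.trans cs↭cs₁ cs₁↭cs₂ , rs₂

labelled-resp-↭ : ∀ {L M} → L ↭ M → LabelledSchedule L → LabelledSchedule M
labelled-resp-↭ L↭M (labelled s cs u vs) with Pointwise-↭ʳ L↭M vs
... | cs′ , cs↭cs′ , vs′ = labelled s cs′ (PermS.Unique-resp-↭ (setoid ℕ) (↭⇒↭ₛ cs↭cs′) u) vs′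

labelled-mono-head : ∀ {p q L} → p ≤ q → LabelledSchedule (p ∷ L) → LabelledSchedule (q ∷ L)
labelled-mono-head p≤q (labelled s cs u (v ∷ vs)) = labelled s cs u (Visits-mono p≤q v ∷ vs)

parity-choice : ∀ m π → ∃ λ k → m ≤ k × k ≤ suc m × parity k ≡ π
parity-choice zero 0ℙ = 0 , ≤-refl , z≤n , refl
parity-choice zero 1ℙ = 1 , z≤n , ≤-refl , refl
parity-choice (suc zero) 0ℙ = 2 , n≤1+n 1 , ≤-refl , refl
parity-choice (suc zero) 1ℙ = 1 , ≤-refl , n≤1+n 1 , refl
parity-choice (suc (suc m)) π with parity-choice m π
... | k , m≤k , k≤1+m , parity-k≡π = suc (suc k) , s≤s (s≤s m≤k) , s≤s (s≤s k≤1+m) , parity-k≡π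

-- The visits to c go alternately to c and c′, by the parity of the number of
-- earlier visits to c; a window of length 2p contains two consecutive ones.
module Alternation (s : ℕ → ℕ) (c c′ : ℕ) where

  count : ℕ → ℕ
  count zero = 0
  count (suc d) with s d ≟ c
  ... | yes _ = suc (count d)
  ... | no _ = count d

  count-visit : ∀ {d} → s d ≡ c → count (suc d) ≡ suc (count d)
  count-visit {d} e with s d ≟ c
  ... | yes _ = refl
  ... | no s≢c = ⊥-elim (s≢c e)

  count-≤-suc : ∀ d → count d ≤ count (suc d)
  count-≤-suc d with s d ≟ c
  ... | yes _ = n≤1+n _
  ... | no _ = ≤-refl

  count-mono : ∀ {u v} → u ≤ v → count u ≤ count v
  count-mono = go ∘ ≤⇒≤′
    where
    go : ∀ {u v} → u ≤′ v → count u ≤ count v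
    go ℕ.≤′-refl = ≤-refl
    go (ℕ.≤′-step u≤′v) = ≤-trans (go u≤′v) (count-≤-suc _)

  count-<-visit : ∀ {u d v} → u ≤ d → d < v → s d ≡ c → count u < count v
  count-<-visit {u} {d} {v} u≤d d<v e = begin-strict
    count u        ≤⟨ count-mono u≤d ⟩
    count d        <⟨ ≤-reflexive (sym (count-visit e)) ⟩
    count (suc d)  ≤⟨ count-mono d<v ⟩
    count v        ∎
    where open ≤-Reasoning

  count-attains : ∀ {u v m} → u ≤ v → count u ≤ m → m < count v →
    ∃ λ d → u ≤ d × d < v × s d ≡ c × count d ≡ m
  count-attains {v = zero} _ _ ()
  count-attains {u} {suc v} {m} u≤1+v count-u≤m m<count-1+v
    with m≤n⇒m<n∨m≡n u≤1+v
  ... | inj₂ refl = ⊥-elim (<-irrefl refl (≤-<-trans count-u≤m m<count-1+v))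
  ... | inj₁ (s≤s u≤v) with m <? count v
  ...   | yes m<count-v =
    let d , u≤d , d<v , visit = count-attains u≤v count-u≤m m<count-v
    in d , u≤d , m<n⇒m<1+n d<v , visit
  ...   | no m≮count-v with s v ≟ c
  ...     | yes e = v , u≤v , ≤-refl , e , ≤-antisym (≮⇒≥ m≮count-v) (≤-pred m<count-1+v)
  ...     | no _ = ⊥-elim (m≮count-v m<count-1+v)

  labelOf : Parity → ℕ
  labelOf 0ℙ = c
  labelOf 1ℙ = c′

  alternating : ℕ → ℕ
  alternating d with s d ≟ c
  ... | yes _ = labelOf (parity (count d))
  ... | no _ = s d

  alternating-visit : ∀ {d} → s d ≡ c → alternating d ≡ labelOf (parity (count d))
  alternating-visit {d} e with s d ≟ c
  ... | yes _ = refl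
  ... | no s≢c = ⊥-elim (s≢c e)

  alternating-other : ∀ {d} → s d ≢ c → alternating d ≡ s d
  alternating-other {d} s≢c with s d ≟ c
  ... | yes e = ⊥-elim (s≢c e)
  ... | no _ = refl

  count-double-window : ∀ {p} → Visits s c p → ∀ t → 2 + count t ≤ count (t + (p + p))
  count-double-window {p} v t with v t | v (t + p)
  ... | d₁ , t≤d₁ , d₁<t+p , e₁ | d₂ , t+p≤d₂ , d₂<t+p+p , e₂ = begin
    2 + count t          ≤⟨ s≤s (count-<-visit t≤d₁ d₁<t+p e₁) ⟩
    suc (count (t + p))  ≤⟨ count-<-visit t+p≤d₂ d₂<t+p+p e₂ ⟩
    count (t + p + p)    ≡⟨ cong count (+-assoc t p p) ⟩
    count (t + (p + p))  ∎
    where open ≤-Reasoning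

  visits-split : ∀ {p} → Visits s c p → ∀ π → Visits alternating (labelOf π) (p + p)
  visits-split {p} v π t with parity-choice (count t) π
  ... | k , count-t≤k , k≤1+count-t , parity-k≡π
    with count-attains (m≤m+n t (p + p)) count-t≤k
           (<-≤-trans (s≤s k≤1+count-t) (count-double-window v t))
  ... | d , t≤d , d<t+2p , e , count-d≡k =
    d , t≤d , d<t+2p , trans (alternating-visit e) (cong labelOf (trans (cong parity count-d≡k) parity-k≡π))

  visits-other : ∀ {e a} → c ≢ e → Visits s e a → Visits alternating e a
  visits-other c≢e v t with v t
  ... | d , t≤d , d<t+a , s-d≡e =
    d , t≤d , d<t+a , trans (alternating-other (λ s-d≡c → c≢e (trans (sym s-d≡c) s-d≡e))) s-d≡e

  pointwise-others : ∀ {cs L} → All (c ≢_) cs →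
    Pointwise (Visits s) cs L → Pointwise (Visits alternating) cs L
  pointwise-others [] [] = []
  pointwise-others (c≢e ∷ c∉cs) (v ∷ vs) = visits-other c≢e v ∷ pointwise-others c∉cs vs

labelled-split : ∀ {p q q′ L} → p + p ≤ q → p + p ≤ q′ →
  LabelledSchedule (p ∷ L) → LabelledSchedule (q ∷ q′ ∷ L)
labelled-split 2p≤q 2p≤q′ (labelled s (c ∷ cs) (c∉cs ∷ u) (v ∷ vs)) =
  labelled alternating (c ∷ c′ ∷ cs) ((c≢c′ ∷ c∉cs) ∷ c′∉cs ∷ u)
    (Visits-mono 2p≤q (visits-split v 0ℙ) ∷ Visits-mono 2p≤q′ (visits-split v 1ℙ) ∷
     pointwise-others c∉cs vs)
  where
  c′ = suc (max c cs)
  open Alternation s c c′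
  c≢c′ : c ≢ c′
  c≢c′ = <⇒≢ (s≤s (⊥≤max c cs))
  c′∉cs : All (c′ ≢_) cs
  c′∉cs = All.map (λ x≤max → >⇒≢ (s≤s x≤max)) (xs≤max c cs)

-- The body of pfoldStep on its sorted list, branching by with so that case
-- analysis on the comparisons computes.
foldDescending : ℚ → List ℚ → List ℚ
foldDescending θ [] = []
foldDescending θ (a ∷ []) with θ ℚP.<? a
... | yes _ = θ ∷ []
... | no _ = a ∷ []
foldDescending θ (a ∷ b ∷ rest) with θ ℚP.<? a | θ ℚP.<? b
... | yes _ | yes _ = ½ ℚ.* b ∷ rest
... | yes _ | no _ = θ ∷ b ∷ rest
... | no _ | _ = a ∷ b ∷ rest

pfoldStep≡foldDescending : ∀ θ xs → pfoldStep θ xs ≡ foldDescending θ (reverse (sort xs))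
pfoldStep≡foldDescending θ xs with reverse (sort xs)
... | [] = refl
... | a ∷ [] with θ ℚP.<? a
...   | yes lt rewrite dec-true (θ ℚP.<? a) lt = refl
...   | no ¬lt rewrite dec-false (θ ℚP.<? a) ¬lt = refl
pfoldStep≡foldDescending θ xs | a ∷ b ∷ rest with θ ℚP.<? a | θ ℚP.<? b
...   | yes lt | yes lt′ rewrite dec-true (θ ℚP.<? a) lt | dec-true (θ ℚP.<? b) lt′ = refl
...   | yes lt | no ¬lt′ rewrite dec-true (θ ℚP.<? a) lt | dec-false (θ ℚP.<? b) ¬lt′ = refl
...   | no ¬lt | _ rewrite dec-false (θ ℚP.<? a) ¬lt = refl

AllPairs-reverse : ∀ {A : Set} {R : A → A → Set} {xs} → AllPairs R xs → AllPairs (flip R) (reverse xs)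
AllPairs-reverse [] = []
AllPairs-reverse {xs = x ∷ xs} (Rx ∷ Rxs) rewrite ListP.unfold-reverse x xs =
  AllPairsP.++⁺ (AllPairs-reverse Rxs) ([] ∷ [])
    (PermP.All-resp-↭ (Perm.↭-sym (PermP.↭-reverse xs)) (All.map (_∷ []) Rx))

reverse-sort-descending : ∀ xs → AllPairs ℚ._≥_ (reverse (sort xs))
reverse-sort-descending xs = AllPairs-reverse (Linked⇒AllPairs ℚP.≤-trans (sort-↗ xs))

reverse-sort-↭ : ∀ xs → reverse (sort xs) ↭ xs
reverse-sort-↭ xs = Perm.↭-trans (PermP.↭-reverse (sort xs)) (sort-↭ xs)

0≤foldDescending : ∀ {θ ys} → 0ℚ ℚ.≤ θ → All (0ℚ ℚ.≤_) ys → All (0ℚ ℚ.≤_) (foldDescending θ ys)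
0≤foldDescending {ys = []} _ [] = []
0≤foldDescending {θ} {a ∷ []} 0≤θ (0≤a ∷ []) with θ ℚP.<? a
... | yes _ = 0≤θ ∷ []
... | no _ = 0≤a ∷ []
0≤foldDescending {θ} {a ∷ b ∷ rest} 0≤θ (0≤a ∷ 0≤b ∷ 0≤rest) with θ ℚP.<? a | θ ℚP.<? b
... | yes _ | yes _ = 0≤* 0≤½ 0≤b ∷ 0≤rest
... | yes _ | no _ = 0≤θ ∷ 0≤b ∷ 0≤rest
... | no _ | _ = 0≤a ∷ 0≤b ∷ 0≤rest

labelled-foldDescending : ∀ {θ ys} → 0ℚ ℚ.≤ θ → All (0ℚ ℚ.≤_) ys → AllPairs ℚ._≥_ ys →
  LabelledSchedule (map scale97ℚ (foldDescending θ ys)) → LabelledSchedule (map scale97ℚ ys)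
labelled-foldDescending {ys = []} _ _ _ ls = ls
labelled-foldDescending {θ} {a ∷ []} 0≤θ _ _ ls with θ ℚP.<? a
... | yes θ<a = labelled-mono-head (scale97ℚ-mono-≤ 0≤θ (ℚP.<⇒≤ θ<a)) ls
... | no _ = ls
labelled-foldDescending {θ} {a ∷ b ∷ rest} 0≤θ (_ ∷ 0≤b ∷ _) ((b≤a ∷ _) ∷ _) ls
  with θ ℚP.<? a | θ ℚP.<? b
... | yes _ | yes _ =
  labelled-split (≤-trans (scale97ℚ-half 0≤b) (scale97ℚ-mono-≤ 0≤b b≤a)) (scale97ℚ-half 0≤b) ls
... | yes θ<a | no _ = labelled-mono-head (scale97ℚ-mono-≤ 0≤θ (ℚP.<⇒≤ θ<a)) ls
... | no _ | _ = ls

0≤pfoldStep : ∀ {θ xs} → 0ℚ ℚ.≤ θ → All (0ℚ ℚ.≤_) xs → All (0ℚ ℚ.≤_) (pfoldStep θ xs)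
0≤pfoldStep {θ} {xs} 0≤θ 0≤xs rewrite pfoldStep≡foldDescending θ xs =
  0≤foldDescending 0≤θ (PermP.All-resp-↭ (Perm.↭-sym (reverse-sort-↭ xs)) 0≤xs)

labelled-pfoldStep : ∀ {θ xs} → 0ℚ ℚ.≤ θ → All (0ℚ ℚ.≤_) xs →
  LabelledSchedule (map scale97ℚ (pfoldStep θ xs)) → LabelledSchedule (map scale97ℚ xs)
labelled-pfoldStep {θ} {xs} 0≤θ 0≤xs ls rewrite pfoldStep≡foldDescending θ xs =
  labelled-resp-↭ (PermP.map⁺ scale97ℚ (reverse-sort-↭ xs))
    (labelled-foldDescending 0≤θ (PermP.All-resp-↭ (Perm.↭-sym (reverse-sort-↭ xs)) 0≤xs)
      (reverse-sort-descending xs) ls)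

labelled-iter-pfoldStep : ∀ {θ} n {xs} → 0ℚ ℚ.≤ θ → All (0ℚ ℚ.≤_) xs →
  LabelledSchedule (map scale97ℚ (iter n (pfoldStep θ) xs)) → LabelledSchedule (map scale97ℚ xs)
labelled-iter-pfoldStep zero _ _ ls = ls
labelled-iter-pfoldStep (suc n) 0≤θ 0≤xs ls =
  labelled-pfoldStep 0≤θ 0≤xs (labelled-iter-pfoldStep n 0≤θ (0≤pfoldStep 0≤θ 0≤xs) ls)

lemma5p3 : (A : List ℕ) → All (0 <_) A → (θ : ℕ) →
    Schedulable (map scale97ℚ (pfold θ (map toℚ A))) →
    Schedulable (map scale97ℕ A)
lemma5p3 [] _ θ (s , _) with s 0
... | ()
lemma5p3 A@(_ ∷ _) _ θ sched =
  labelled⇒schedulable (subst LabelledSchedule scale97ℚ∘toℚ≡scale97ℕ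
    (labelled-iter-pfoldStep (length (map toℚ A)) (0≤toℚ θ) (AllP.map⁺ (All.universal 0≤toℚ A))
      (schedulable⇒labelled sched)))
  where
  scale97ℚ∘toℚ≡scale97ℕ : map scale97ℚ (map toℚ A) ≡ map scale97ℕ A
  scale97ℚ∘toℚ≡scale97ℕ = trans (sym (ListP.map-∘ A)) (ListP.map-cong scale97ℚ-toℚ A)
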